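{- For every $n\ge 0$, the simplicial complex $D_n$ of partial partitions of $[n]$ is shellable (in the nonpure sense).
   Context: $[n]=\{1,\dots,n\}$. A partial partition of $[n]$ is a partition of some subset $I\subseteq[n]$ (including $I=\emptyset$), i.e. a set of pairwise disjoint nonempty subsets (blocks) of $[n]$. $D_n$ is the abstract simplicial complex whose vertices are the nonempty subsets of $[n]$ and whose faces are the partial partitions of $[n]$ (a subset of a partial partition is again a partial partition); its facets are exactly the partitions of $[n]$, of various sizes, so $D_n$ is in general not pure. A simplicial complex $\Delta$ is shellable if its facets can be arranged in a linear order $F_1,\dots,F_t$ such that for every $s=2,\dots,t$ the subcomplex $\big(\bigcup_{r<s}\overline{F_r}\big)\cap\overline{F_s}$ is pure of dimension $\dim(F_s)-1$, where $\overline{F}=\{\tau\in\Delta:\tau\subseteq F\}$. -}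

module Defs where

open import Level using (Level)
open import Data.Nat using (ℕ; suc; _+_)
open import Data.Fin using (Fin) renaming (_<_ to _<ᶠ_)
open import Data.Fin.Subset as S using (Subset; Nonempty; Empty; _∩_)
open import Data.List using (List; length)
open import Data.List.Membership.Propositional using (_∈_)
open import Data.List.Relation.Unary.All using (All)
open import Data.List.Relation.Unary.AllPairs using (AllPairs)
open import Data.List.Relation.Unary.Unique.Propositional using (Unique)
open import Data.Product using (Σ; ∃; _×_)
open import Relation.Binary.PropositionalEquality using (_≡_; _≢_)

-- A face (a finite set of vertices) is represented by a list of
-- vertices, read as a set; a complex is a predicate on such lists.
-- Cardinalities are measured on duplicate-free lists (Unique).

module _ {V : Set} where

  _⊆ₛ_ : List V → List V → Set
  τ ⊆ₛ σ = ∀ {v} → v ∈ τ → v ∈ σ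

  _≈ₛ_ : List V → List V → Set
  τ ≈ₛ σ = τ ⊆ₛ σ × σ ⊆ₛ τ

  IsFacet : (List V → Set) → List V → Set
  IsFacet Γ F = Γ F × (∀ σ → Γ σ → F ⊆ₛ σ → σ ⊆ₛ F)

  closure : (List V → Set) → List V → List V → Set
  closure Δ F τ = Δ τ × τ ⊆ₛ F

  -- a complex Γ is pure of dimension m - 2, i.e. every facet τ of Γ
  -- satisfies |τ| = m - 1  (written suc |τ| ≡ m, so that no facet can
  -- exist when m = 0, dimension -2 being impossible)
  PureOneBelow : (List V → Set) → ℕ → Set
  PureOneBelow Γ m = ∀ τ → Unique τ → IsFacet Γ τ → suc (length τ) ≡ m

  -- Shellability (nonpure sense): the facets of Δ can be listed
  -- F 0, …, F (t-1), each facet exactly once, such that for every s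
  -- other than the first one, (⋃_{r<s} closure(F r)) ∩ closure(F s)
  -- is pure of dimension dim(F s) - 1 = |F s| - 2.
  record Shelling (Δ : List V → Set) : Set where
    field
      t          : ℕ
      F          : Fin t → List V
      F-unique   : ∀ i → Unique (F i)
      F-facet    : ∀ i → IsFacet Δ (F i)
      F-complete : ∀ G → IsFacet Δ G → ∃ λ i → F i ≈ₛ G
      F-distinct : ∀ i j → F i ≈ₛ F j → i ≡ j
      F-shell    : ∀ (s : Fin t) → Σ (Fin t) (λ r → r <ᶠ s) →
                   PureOneBelow
                     (λ τ → Σ (Fin t) (λ r → r <ᶠ s × closure Δ (F r) τ)
                            × closure Δ (F s) τ)
                     (length (F s))

  Shellable : (List V → Set) → Set
  Shellable Δ = Shelling Δ

-- Vertices: nonempty subsets of [n]; faces: finite sets of pairwise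
-- disjoint nonempty subsets (pairwise disjointness of a list of
-- nonempty sets also forces the list to be duplicate-free).

Disjoint : ∀ {n} → Subset n → Subset n → Set
Disjoint p q = Empty (p ∩ q)

IsPartialPartition : ∀ {n} → List (Subset n) → Set
IsPartialPartition τ = All Nonempty τ × AllPairs Disjoint τ

D : (n : ℕ) → List (Subset n) → Set
D n = IsPartialPartition {n}

-- Encode a partition of [n] by the map sending each point to the largest
-- element of its block: these are exactly the maps f with x ≤ f x and
-- f ∘ f = f, and a refinement of a partition has a pointwise smaller map.
-- Listing the partitions in the lexicographic order of their maps therefore
-- puts every proper refinement of a partition before it. Let τ be a facet of
-- the overlap, with τ ⊆ F r ∩ F s and r < s. As F s does not refine F r, some
-- block B of F s is not a block of F r and contains two points x ≢ y.
-- Splitting x off B gives an earlier partition containing F s ∖ {B}, so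
-- F s ∖ {B} lies in the overlap; it contains τ because B ∉ F r, hence equals
-- τ by maximality, and |τ| = |F s| - 1.
module Submission where

open import Level using (0ℓ)
open import Function using (_∘_; mk⇔)
open import Data.Empty using (⊥-elim)
open import Data.Product using (Σ; ∃; _×_; _,_; proj₁; proj₂)
open import Data.Sum using (_⊎_; inj₁; inj₂)
open import Data.Nat using (ℕ; zero; suc; z≤n; s≤s)
open import Data.Nat.Properties using (<⇒≱; ≮⇒≥)
open import Data.Fin using (Fin; zero; suc) renaming (_<_ to _<ᶠ_; _≤_ to _≤ᶠ_)
import Data.Fin.Properties as FinP
open import Data.Fin.Subset using (Subset; Nonempty; Empty; ⁅_⁆) renaming (_∈_ to _∈ˢ_; _⊆_ to _⊆ˢ_)
open import Data.Fin.Subset.Properties using (x∈p∩q⁺; x∈p∩q⁻; ∩-comm; ⊆-antisym; x∈⁅x⁆; x∈⁅y⁆⇒x≡y; _∈?_)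
import Data.Bool.Properties as BoolP
open import Data.List using (List; []; _∷_; [_]; length; map; filter; concatMap; lookup; allFin)
open import Data.List.Membership.Propositional using (_∈_; _∉_; find; lose)
open import Data.List.Membership.Propositional.Properties
  using (∈-lookup; ∈-map⁺; ∈-map⁻; ∈-concat⁺′; ∈-allFin; ∈-filter⁺; ∈-filter⁻)
open import Data.List.Membership.Propositional.Properties.WithK using (unique∧set⇒bag)
import Data.List.Membership.DecPropositional as DecMembership
open import Data.List.Relation.Binary.BagAndSetEquality using (∼bag⇒↭)
open import Data.List.Relation.Binary.Permutation.Propositional.Properties using (↭-length)
open import Data.List.Relation.Unary.Any using (here; there)
import Data.List.Relation.Unary.Any as Any
open import Data.List.Relation.Unary.Any.Properties using (lookup-index)
open import Data.List.Relation.Unary.All as All using (All; []; _∷_)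
import Data.List.Relation.Unary.All.Properties as AllP
open import Data.List.Relation.Unary.AllPairs as AllPairs using (AllPairs; []; _∷_)
import Data.List.Relation.Unary.AllPairs.Properties as AllPairsP
open import Data.List.Relation.Unary.Unique.Propositional using (Unique)
import Data.List.Relation.Unary.Unique.Propositional.Properties as UniqueP
open import Data.Vec using (Vec; []; _∷_; tabulate) renaming (lookup to vlookup)
open import Data.Vec.Properties using (lookup∘tabulate; lookup⇒[]=; []=⇒lookup; ≡-dec)
open import Data.Vec.Relation.Binary.Lex.Strict using (Lex-<; base; this; next)
open import Relation.Binary using (Rel; Symmetric; DecidableEquality)
open import Relation.Binary.PropositionalEquality
  using (_≡_; _≢_; refl; sym; trans; cong; subst; module ≡-Reasoning)
open import Relation.Nullary using (¬_; yes; no; does; ¬?)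
open import Relation.Nullary.Decidable using (dec-true; _×-dec_; decidable-stable)
open import Relation.Unary using (Pred; Decidable)

open import Defs

module _ {A : Set} {R : Rel A 0ℓ} where

  AllPairs-lookup : ∀ {xs} → AllPairs R xs → ∀ {i j} → i <ᶠ j → R (lookup xs i) (lookup xs j)
  AllPairs-lookup (Rx ∷ _)  {zero}  {suc j} _         = All.lookup Rx (∈-lookup j)
  AllPairs-lookup (_ ∷ Rxs) {suc i} {suc j} (s≤s i<j) = AllPairs-lookup Rxs i<j

  AllPairs-∈⇒≡⊎R : Symmetric R → ∀ {xs a b} → AllPairs R xs → a ∈ xs → b ∈ xs → a ≡ b ⊎ R a b
  AllPairs-∈⇒≡⊎R R-sym (_ ∷ _)   (here refl) (here refl) = inj₁ refl
  AllPairs-∈⇒≡⊎R R-sym (Rx ∷ _)  (here refl) (there b∈)  = inj₂ (All.lookup Rx b∈)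
  AllPairs-∈⇒≡⊎R R-sym (Rx ∷ _)  (there a∈)  (here refl) = inj₂ (R-sym (All.lookup Rx a∈))
  AllPairs-∈⇒≡⊎R R-sym (_ ∷ Rxs) (there a∈)  (there b∈)  = AllPairs-∈⇒≡⊎R R-sym Rxs a∈ b∈

≈ₛ⇒length-≡ : ∀ {A : Set} {xs ys : List A} → Unique xs → Unique ys → xs ≈ₛ ys → length xs ≡ length ys
≈ₛ⇒length-≡ xs! ys! (xs⊆ys , ys⊆xs) =
  ↭-length (∼bag⇒↭ (unique∧set⇒bag xs! ys! (mk⇔ xs⊆ys ys⊆xs)))

module _ {k : ℕ} where

  _<ₗₑₓ_ : ∀ {m} → Rel (Vec (Fin k) m) 0ℓ
  _<ₗₑₓ_ = Lex-< _≡_ _<ᶠ_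

  vecs : ∀ m → List (Vec (Fin k) m)
  vecs zero    = [ [] ]
  vecs (suc m) = concatMap (λ a → map (a ∷_) (vecs m)) (allFin k)

  ∈-vecs : ∀ {m} (v : Vec (Fin k) m) → v ∈ vecs m
  ∈-vecs []              = here refl
  ∈-vecs {suc m} (a ∷ v) =
    ∈-concat⁺′ (∈-map⁺ (a ∷_) (∈-vecs v)) (∈-map⁺ (λ a → map (a ∷_) (vecs m)) (∈-allFin a))

  vecs-sorted : ∀ m → AllPairs _<ₗₑₓ_ (vecs m)
  vecs-sorted zero    = [] ∷ []
  vecs-sorted (suc m) = AllPairsP.concat⁺
    (AllP.map⁺ (All.universal (λ _ → AllPairsP.map⁺ (AllPairs.map (next refl) (vecs-sorted m))) (allFin k)))
    (AllPairsP.map⁺ (AllPairsP.tabulate⁺-< λ a<b →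
      AllP.map⁺ (All.universal (λ _ → AllP.map⁺ (All.universal (λ _ → this a<b refl) (vecs m))) (vecs m))))

  ≤-pointwise⇒≮ₗₑₓ : ∀ {m} (v w : Vec (Fin k) m) → (∀ i → vlookup v i ≤ᶠ vlookup w i) → ¬ (w <ₗₑₓ v)
  ≤-pointwise⇒≮ₗₑₓ []      []      _   (base ())
  ≤-pointwise⇒≮ₗₑₓ (a ∷ v) (b ∷ w) v≤w (this b<a _)    = <⇒≱ b<a (v≤w zero)
  ≤-pointwise⇒≮ₗₑₓ (a ∷ v) (b ∷ w) v≤w (next refl w<v) = ≤-pointwise⇒≮ₗₑₓ v w (v≤w ∘ suc) w<v

greatest : ∀ {k} {P : Pred (Fin k) 0ℓ} → Decidable P → ∃ P → ∃ λ y → P y × (∀ z → P z → z ≤ᶠ y)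
greatest {suc k} {P} P? (x , Px) with FinP.any? (P? ∘ suc)
... | yes P∘suc = let (y , Py , ≤y) = greatest (P? ∘ suc) P∘suc in
  suc y , Py , λ { zero _ → z≤n ; (suc z) Pz → s≤s (≤y z Pz) }
... | no ¬P∘suc = zero , P-zero x Px , λ { zero _ → z≤n ; (suc z) Pz → ⊥-elim (¬P∘suc (z , Pz)) }
  where
    P-zero : ∀ x → P x → P zero
    P-zero zero    Px = Px
    P-zero (suc x) Px = ⊥-elim (¬P∘suc (x , Px))

module _ {n} {P : Pred (Fin n) 0ℓ} (P? : Decidable P) where

  select : Subset n
  select = tabulate (does ∘ P?)

  ∈-select⁺ : ∀ {y} → P y → y ∈ˢ select
  ∈-select⁺ {y} Py = lookup⇒[]= y select (trans (lookup∘tabulate (does ∘ P?) y) (dec-true (P? y) Py))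

  ∈-select⁻ : ∀ {y} → y ∈ˢ select → P y
  ∈-select⁻ {y} y∈ with P? y | trans (sym (lookup∘tabulate (does ∘ P?) y)) ([]=⇒lookup y∈)
  ... | yes Py | _ = Py
  ... | no _   | ()

module PartialPartitions (n : ℕ) where

  Block : Set
  Block = Subset n

  _≟ᵇ_ : DecidableEquality Block
  _≟ᵇ_ = ≡-dec BoolP._≟_

  open DecMembership _≟ᵇ_ using () renaming (_∈?_ to _∈ᴸ?_)

  Covers : List Block → Set
  Covers P = ∀ x → ∃ λ p → p ∈ P × x ∈ˢ p

  Refines : List Block → List Block → Set
  Refines P Q = ∀ {b} → b ∈ P → ∃ λ c → c ∈ Q × b ⊆ˢ c

  ⊆ₛ⇒Refines : ∀ {P Q} → P ⊆ₛ Q → Refines P Q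
  ⊆ₛ⇒Refines P⊆Q {b} b∈P = b , P⊆Q b∈P , λ z∈b → z∈b

  Disjoint-sym : Symmetric (Disjoint {n})
  Disjoint-sym {p} {q} = subst Empty (∩-comm p q)

  Disjoint⇒≢ : ∀ {p q : Block} → Nonempty p → Disjoint p q → p ≢ q
  Disjoint⇒≢ (x , x∈p) p∩q=∅ refl = p∩q=∅ (x , x∈p∩q⁺ (x∈p , x∈p))

  blocks-meet⇒≡ : ∀ {P p q x} → D n P → p ∈ P → q ∈ P → x ∈ˢ p → x ∈ˢ q → p ≡ q
  blocks-meet⇒≡ {x = x} (_ , disjoint) p∈P q∈P x∈p x∈q
    with AllPairs-∈⇒≡⊎R Disjoint-sym disjoint p∈P q∈P
  ... | inj₁ p≡q   = p≡q
  ... | inj₂ p∩q=∅ = ⊥-elim (p∩q=∅ (x , x∈p∩q⁺ (x∈p , x∈q)))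

  partialPartition⇒Unique : ∀ {P} → D n P → Unique P
  partialPartition⇒Unique ([] , []) = []
  partialPartition⇒Unique (p≠∅ ∷ nonempty , p-disjoint ∷ disjoint) =
    All.map (Disjoint⇒≢ p≠∅) p-disjoint ∷ partialPartition⇒Unique (nonempty , disjoint)

  covers⇒facet : ∀ {P} → D n P → Covers P → IsFacet (D n) P
  covers⇒facet {P} P-pp cover = P-pp , λ σ σ-pp P⊆σ {p} p∈σ →
    let (x , x∈p) = All.lookup (proj₁ σ-pp) p∈σ
        (q , q∈P , x∈q) = cover x
    in subst (_∈ P) (blocks-meet⇒≡ σ-pp (P⊆σ q∈P) p∈σ x∈q x∈p) q∈P

  facet⇒covers : ∀ {P} → IsFacet (D n) P → Covers P
  facet⇒covers {P} ((nonempty , disjoint) , maximal) x with Any.any? (x ∈?_) P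
  ... | yes x∈⋃P = find x∈⋃P
  ... | no x∉⋃P  = ⊥-elim (x∉⋃P (lose (maximal (⁅ x ⁆ ∷ P) extended there (here refl)) (x∈⁅x⁆ x)))
    where
      extended : D n (⁅ x ⁆ ∷ P)
      extended = (x , x∈⁅x⁆ x) ∷ nonempty
               , All.tabulate (λ {q} q∈P (y , y∈) → let (y∈⁅x⁆ , y∈q) = x∈p∩q⁻ _ _ y∈ in
                   x∉⋃P (lose q∈P (subst (_∈ˢ q) (x∈⁅y⁆⇒x≡y x y∈⁅x⁆) y∈q))) ∷ disjoint

  without : Block → List Block → List Block
  without B = filter (λ c → ¬? (c ≟ᵇ B))

  ∈-without⁻ : ∀ {B c} P → c ∈ without B P → c ∈ P × c ≢ B
  ∈-without⁻ P = ∈-filter⁻ _ {xs = P}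

  ⊆-∷-without : ∀ {B} P → P ⊆ₛ (B ∷ without B P)
  ⊆-∷-without {B} P {c} c∈P with c ≟ᵇ B
  ... | yes refl = here refl
  ... | no c≢B   = there (∈-filter⁺ _ c∈P c≢B)

  without-partial : ∀ {B P} → D n P → D n (without B P)
  without-partial {P = P} (nonempty , disjoint) =
    All.tabulate (λ c∈ → All.lookup nonempty (proj₁ (∈-without⁻ P c∈))) , AllPairsP.filter⁺ _ disjoint

  Splittable : Block → Set
  Splittable B = ∃ λ x → ∃ λ y → x ∈ˢ B × y ∈ˢ B × x ≢ y

  splittable? : Decidable Splittable
  splittable? B = FinP.any? λ x → FinP.any? λ y → (x ∈? B) ×-dec (y ∈? B) ×-dec ¬? (x FinP.≟ y)

  splittable⊎refines : ∀ {P Q} → D n P → Covers Q →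
                       (∃ λ B → B ∈ P × B ∉ Q × Splittable B) ⊎ Refines P Q
  splittable⊎refines {P} {Q} (nonempty , _) Q-cover
    with Any.any? (λ B → ¬? (B ∈ᴸ? Q) ×-dec splittable? B) P
  ... | yes found = let (B , B∈P , B∉Q , B-splittable) = find found in inj₁ (B , B∈P , B∉Q , B-splittable)
  ... | no none   = inj₂ refines
    where
      refines : Refines P Q
      refines {b} b∈P with b ∈ᴸ? Q | All.lookup nonempty b∈P
      ... | yes b∈Q | _ = b , b∈Q , λ z∈b → z∈b
      ... | no b∉Q  | x , x∈b with Q-cover x
      ... | c , c∈Q , x∈c = c , c∈Q , λ {z} z∈b →
        subst (_∈ˢ c) (decidable-stable (x FinP.≟ z) λ x≢z →
                         none (lose b∈P (b∉Q , x , z , x∈b , z∈b , x≢z))) x∈c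

  delete : Fin n → Block → Block
  delete x B = select λ z → (z ∈? B) ×-dec ¬? (z FinP.≟ x)

  ∈-delete⁺ : ∀ {x B z} → z ∈ˢ B → z ≢ x → z ∈ˢ delete x B
  ∈-delete⁺ {x} {B} z∈B z≢x = ∈-select⁺ (λ z → (z ∈? B) ×-dec ¬? (z FinP.≟ x)) (z∈B , z≢x)

  ∈-delete⁻ : ∀ {x B z} → z ∈ˢ delete x B → z ∈ˢ B × z ≢ x
  ∈-delete⁻ {x} {B} = ∈-select⁻ λ z → (z ∈? B) ×-dec ¬? (z FinP.≟ x)

  split : Fin n → Block → List Block → List Block
  split x B P = delete x B ∷ ⁅ x ⁆ ∷ without B P

  module Split {P B x y} (P-pp : D n P) (B∈P : B ∈ P) (x∈B : x ∈ˢ B) (y∈B : y ∈ˢ B) (x≢y : x ≢ y) where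

    split-partial : D n (split x B P)
    split-partial = ((y , ∈-delete⁺ y∈B (x≢y ∘ sym)) ∷ (x , x∈⁅x⁆ x) ∷ proj₁ rest-pp)
                  , ((delete-⁅x⁆ ∷ All.tabulate delete-rest) ∷ All.tabulate ⁅x⁆-rest ∷ proj₂ rest-pp)
      where
        rest-pp : D n (without B P)
        rest-pp = without-partial P-pp

        delete-⁅x⁆ : Disjoint (delete x B) ⁅ x ⁆
        delete-⁅x⁆ (z , z∈) = let (z∈delete , z∈⁅x⁆) = x∈p∩q⁻ _ _ z∈ in
          proj₂ (∈-delete⁻ z∈delete) (x∈⁅y⁆⇒x≡y x z∈⁅x⁆)

        delete-rest : ∀ {c} → c ∈ without B P → Disjoint (delete x B) c
        delete-rest c∈ (z , z∈) =
          let (z∈delete , z∈c) = x∈p∩q⁻ _ _ z∈ ; (c∈P , c≢B) = ∈-without⁻ P c∈ in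
          c≢B (blocks-meet⇒≡ P-pp c∈P B∈P z∈c (proj₁ (∈-delete⁻ z∈delete)))

        ⁅x⁆-rest : ∀ {c} → c ∈ without B P → Disjoint ⁅ x ⁆ c
        ⁅x⁆-rest {c} c∈ (z , z∈) =
          let (z∈⁅x⁆ , z∈c) = x∈p∩q⁻ _ _ z∈ ; (c∈P , c≢B) = ∈-without⁻ P c∈ in
          c≢B (blocks-meet⇒≡ P-pp c∈P B∈P (subst (_∈ˢ c) (x∈⁅y⁆⇒x≡y x z∈⁅x⁆) z∈c) x∈B)

    split-covers : Covers P → Covers (split x B P)
    split-covers cover z with cover z
    ... | p , p∈P , z∈p with p ≟ᵇ B | z FinP.≟ x
    ... | no p≢B   | _        = p , there (there (∈-filter⁺ _ p∈P p≢B)) , z∈p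
    ... | yes refl | yes refl = ⁅ x ⁆ , there (here refl) , x∈⁅x⁆ x
    ... | yes refl | no z≢x   = delete x B , here refl , ∈-delete⁺ z∈p z≢x

    split-refines : Refines (split x B P) P
    split-refines (here refl)         = B , B∈P , λ z∈ → proj₁ (∈-delete⁻ z∈)
    split-refines (there (here refl)) = B , B∈P , λ z∈ → subst (_∈ˢ B) (sym (x∈⁅y⁆⇒x≡y x z∈)) x∈B
    split-refines (there (there c∈))  = _ , proj₁ (∈-without⁻ P c∈) , λ z∈ → z∈

    ∉-split : B ∉ split x B P
    ∉-split (here B≡delete)      = proj₂ (∈-delete⁻ (subst (x ∈ˢ_) B≡delete x∈B)) refl
    ∉-split (there (here B≡⁅x⁆)) = x≢y (sym (x∈⁅y⁆⇒x≡y x (subst (y ∈ˢ_) B≡⁅x⁆ y∈B)))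
    ∉-split (there (there B∈))   = proj₂ (∈-without⁻ P B∈) refl

  Map : Set
  Map = Vec (Fin n) n

  infixl 9 _!_
  _!_ : Map → Fin n → Fin n
  _!_ = vlookup

  Canonical : Map → Set
  Canonical f = ∀ x → x ≤ᶠ f ! x × f ! (f ! x) ≡ f ! x

  canonical? : Decidable Canonical
  canonical? f = FinP.all? λ x → (x FinP.≤? f ! x) ×-dec (f ! (f ! x) FinP.≟ f ! x)

  fixedPoints : Map → List (Fin n)
  fixedPoints f = filter (λ x → f ! x FinP.≟ x) (allFin n)

  ∈-fixedPoints⁺ : ∀ f {r} → f ! r ≡ r → r ∈ fixedPoints f
  ∈-fixedPoints⁺ f {r} = ∈-filter⁺ _ (∈-allFin r)

  ∈-fixedPoints⁻ : ∀ f {r} → r ∈ fixedPoints f → f ! r ≡ r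
  ∈-fixedPoints⁻ f r∈ = proj₂ (∈-filter⁻ (λ x → f ! x FinP.≟ x) {xs = allFin n} r∈)

  fibre : Map → Fin n → Block
  fibre f r = select λ y → f ! y FinP.≟ r

  ∈-fibre⁺ : ∀ f {r y} → f ! y ≡ r → y ∈ˢ fibre f r
  ∈-fibre⁺ f {r} = ∈-select⁺ λ y → f ! y FinP.≟ r

  ∈-fibre⁻ : ∀ f {r y} → y ∈ˢ fibre f r → f ! y ≡ r
  ∈-fibre⁻ f {r} = ∈-select⁻ λ y → f ! y FinP.≟ r

  blocks : Map → List Block
  blocks f = map (fibre f) (fixedPoints f)

  blocks-partial : ∀ f → D n (blocks f)
  blocks-partial f = AllP.map⁺ (All.tabulate λ {r} r∈ → r , ∈-fibre⁺ f (∈-fixedPoints⁻ f r∈))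
                   , AllPairsP.map⁺ (AllPairs.map fibres-disjoint (AllPairsP.filter⁺ _ (UniqueP.allFin⁺ n)))
    where
      fibres-disjoint : ∀ {r s} → r ≢ s → Disjoint (fibre f r) (fibre f s)
      fibres-disjoint r≢s (y , y∈) = let (y∈r , y∈s) = x∈p∩q⁻ _ _ y∈ in
        r≢s (trans (sym (∈-fibre⁻ f y∈r)) (∈-fibre⁻ f y∈s))

  blocks-covers : ∀ {f} → Canonical f → Covers (blocks f)
  blocks-covers {f} canonical x =
    fibre f (f ! x) , ∈-map⁺ (fibre f) (∈-fixedPoints⁺ f (proj₂ (canonical x))) , ∈-fibre⁺ f refl

  refines⇒≤ : ∀ {f g} → Canonical f → Canonical g → Refines (blocks f) (blocks g) → ∀ y → f ! y ≤ᶠ g ! y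
  refines⇒≤ {f} {g} f-canonical g-canonical refines y
    with refines (∈-map⁺ (fibre f) (∈-fixedPoints⁺ f (proj₂ (f-canonical y))))
  ... | c , c∈ , fibre⊆c with ∈-map⁻ (fibre g) c∈
  ... | r , _ , refl = subst (f ! y ≤ᶠ_) (trans g[fy]≡r (sym g[y]≡r)) (proj₁ (g-canonical (f ! y)))
    where
      g[y]≡r : g ! y ≡ r
      g[y]≡r = ∈-fibre⁻ g (fibre⊆c (∈-fibre⁺ f refl))

      g[fy]≡r : g ! (f ! y) ≡ r
      g[fy]≡r = ∈-fibre⁻ g (fibre⊆c (∈-fibre⁺ f (proj₂ (f-canonical y))))

  module _ {G} (G-pp : D n G) (G-cover : Covers G) where
    private
      blockOf : Fin n → Block
      blockOf x = proj₁ (G-cover x)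

      blockOf-∈ : ∀ x → blockOf x ∈ G
      blockOf-∈ x = proj₁ (proj₂ (G-cover x))

      ∈-blockOf : ∀ x → x ∈ˢ blockOf x
      ∈-blockOf x = proj₂ (proj₂ (G-cover x))

      blockOf-unique : ∀ {x p} → p ∈ G → x ∈ˢ p → blockOf x ≡ p
      blockOf-unique {x} p∈G x∈p = blocks-meet⇒≡ G-pp (blockOf-∈ x) p∈G (∈-blockOf x) x∈p

      top : Fin n → Fin n
      top x = proj₁ (greatest (_∈? blockOf x) (x , ∈-blockOf x))

      top-∈ : ∀ x → top x ∈ˢ blockOf x
      top-∈ x = proj₁ (proj₂ (greatest (_∈? blockOf x) (x , ∈-blockOf x)))

      ≤-top : ∀ {x y} → y ∈ˢ blockOf x → y ≤ᶠ top x
      ≤-top {x} {y} = proj₂ (proj₂ (greatest (_∈? blockOf x) (x , ∈-blockOf x))) y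

      top-cong : ∀ {x y} → blockOf x ≡ blockOf y → top x ≡ top y
      top-cong {x} {y} eq = FinP.≤-antisym (≤-top (subst (top x ∈ˢ_) eq (top-∈ x)))
                                           (≤-top (subst (top y ∈ˢ_) (sym eq) (top-∈ y)))

      top-idem : ∀ x → top (top x) ≡ top x
      top-idem x = top-cong (blockOf-unique (blockOf-∈ x) (top-∈ x))

      f : Map
      f = tabulate top

      f!≡top : ∀ x → f ! x ≡ top x
      f!≡top = lookup∘tabulate top

      f-canonical : Canonical f
      f-canonical x = subst (x ≤ᶠ_) (sym (f!≡top x)) (≤-top (∈-blockOf x)) , (begin
        f ! (f ! x) ≡⟨ cong (f !_) (f!≡top x) ⟩
        f ! top x   ≡⟨ f!≡top (top x) ⟩
        top (top x) ≡⟨ top-idem x ⟩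
        top x       ≡⟨ f!≡top x ⟨
        f ! x       ∎)
        where open ≡-Reasoning

      fibre≡blockOf : ∀ {r} → f ! r ≡ r → fibre f r ≡ blockOf r
      fibre≡blockOf {r} f!r≡r = ⊆-antisym fibre⊆ ⊆fibre
        where
          fibre⊆ : fibre f r ⊆ˢ blockOf r
          fibre⊆ {y} y∈ = subst (y ∈ˢ_) (sym (blockOf-unique (blockOf-∈ y) r∈blockOf-y)) (∈-blockOf y)
            where
              r∈blockOf-y : r ∈ˢ blockOf y
              r∈blockOf-y = subst (_∈ˢ blockOf y) (trans (sym (f!≡top y)) (∈-fibre⁻ f y∈)) (top-∈ y)

          ⊆fibre : blockOf r ⊆ˢ fibre f r
          ⊆fibre {y} y∈ = ∈-fibre⁺ f (begin
            f ! y ≡⟨ f!≡top y ⟩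
            top y ≡⟨ top-cong (blockOf-unique (blockOf-∈ r) y∈) ⟩
            top r ≡⟨ f!≡top r ⟨
            f ! r ≡⟨ f!r≡r ⟩
            r     ∎)
            where open ≡-Reasoning

      blocks⊆G : blocks f ⊆ₛ G
      blocks⊆G b∈ with ∈-map⁻ (fibre f) b∈
      ... | r , r∈ , refl = subst (_∈ G) (sym (fibre≡blockOf (∈-fixedPoints⁻ f r∈))) (blockOf-∈ r)

      G⊆blocks : G ⊆ₛ blocks f
      G⊆blocks {p} p∈G = subst (_∈ blocks f) fibre≡p (∈-map⁺ (fibre f) (∈-fixedPoints⁺ f fixed))
        where
          x : Fin n
          x = proj₁ (All.lookup (proj₁ G-pp) p∈G)

          x∈p : x ∈ˢ p
          x∈p = proj₂ (All.lookup (proj₁ G-pp) p∈G)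

          fixed : f ! (f ! x) ≡ f ! x
          fixed = proj₂ (f-canonical x)

          f!x∈p : f ! x ∈ˢ p
          f!x∈p = subst (_∈ˢ p) (sym (f!≡top x)) (subst (top x ∈ˢ_) (blockOf-unique p∈G x∈p) (top-∈ x))

          fibre≡p : fibre f (f ! x) ≡ p
          fibre≡p = trans (fibre≡blockOf fixed) (blockOf-unique p∈G f!x∈p)

    canonical-complete : ∃ λ f → Canonical f × blocks f ≈ₛ G
    canonical-complete = f , f-canonical , blocks⊆G , G⊆blocks

module LexicographicShelling (n : ℕ) where
  open PartialPartitions n

  canonicalMaps : List Map
  canonicalMaps = filter canonical? (vecs n)

  t : ℕ
  t = length canonicalMaps

  canon : Fin t → Map
  canon = lookup canonicalMaps

  canon-canonical : ∀ i → Canonical (canon i)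
  canon-canonical i = proj₂ (∈-filter⁻ canonical? {xs = vecs n} (∈-lookup i))

  facet : Fin t → List Block
  facet i = blocks (canon i)

  facet-partial : ∀ i → D n (facet i)
  facet-partial i = blocks-partial (canon i)

  facet-covers : ∀ i → Covers (facet i)
  facet-covers i = blocks-covers {canon i} (canon-canonical i)

  refines⇒index-≤ : ∀ {i j} → Refines (facet i) (facet j) → i ≤ᶠ j
  refines⇒index-≤ {i} {j} refines = ≮⇒≥ λ j<i →
    ≤-pointwise⇒≮ₗₑₓ (canon i) (canon j)
      (refines⇒≤ {canon i} {canon j} (canon-canonical i) (canon-canonical j) refines)
      (AllPairs-lookup (AllPairsP.filter⁺ canonical? (vecs-sorted n)) j<i)

  facet-injective : ∀ i j → facet i ≈ₛ facet j → i ≡ j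
  facet-injective i j (i⊆j , j⊆i) =
    FinP.≤-antisym (refines⇒index-≤ (⊆ₛ⇒Refines i⊆j)) (refines⇒index-≤ (⊆ₛ⇒Refines j⊆i))

  facet-complete : ∀ G → IsFacet (D n) G → ∃ λ i → facet i ≈ₛ G
  facet-complete G G-facet with canonical-complete (proj₁ G-facet) (facet⇒covers G-facet)
  ... | f , f-canonical , f≈G = Any.index f∈ , subst (λ g → blocks g ≈ₛ G) (lookup-index f∈) f≈G
    where
      f∈ : f ∈ canonicalMaps
      f∈ = ∈-filter⁺ canonical? (∈-vecs f) f-canonical

  earlier-facet⊇without : ∀ s {B} → B ∈ facet s → Splittable B →
                          ∃ λ k → k <ᶠ s × without B (facet s) ⊆ₛ facet k
  earlier-facet⊇without s {B} B∈s (x , y , x∈B , y∈B , x≢y) =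
    k , k<s , λ c∈ → proj₂ k≈split (there (there c∈))
    where
      open Split (facet-partial s) B∈s x∈B y∈B x≢y

      split-facet : ∃ λ k → facet k ≈ₛ split x B (facet s)
      split-facet = facet-complete _ (covers⇒facet split-partial (split-covers (facet-covers s)))

      k : Fin t
      k = proj₁ split-facet

      k≈split : facet k ≈ₛ split x B (facet s)
      k≈split = proj₂ split-facet

      -- Matching k≡s against refl would make the unifier evaluate k, i.e.
      -- run the whole enumeration of maps.
      k<s : k <ᶠ s
      k<s = FinP.≤∧≢⇒< (refines⇒index-≤ (split-refines ∘ proj₁ k≈split))
                       λ k≡s → ∉-split (proj₁ k≈split (subst (λ i → B ∈ facet i) (sym k≡s) B∈s))

  EarlierOverlap : Fin t → List Block → Set
  EarlierOverlap s τ = Σ (Fin t) (λ r → r <ᶠ s × closure (D n) (facet r) τ) × closure (D n) (facet s) τ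

  shell : ∀ s → Σ (Fin t) (λ r → r <ᶠ s) → PureOneBelow (EarlierOverlap s) (length (facet s))
  shell s _ τ τ! (((r , r<s , _ , τ⊆r) , _ , τ⊆s) , τ-maximal)
    with splittable⊎refines (facet-partial s) (facet-covers r)
  ... | inj₂ s-refines-r = ⊥-elim (<⇒≱ r<s (refines⇒index-≤ s-refines-r))
  ... | inj₁ (B , B∈s , B∉r , B-splittable) =
    sym (≈ₛ⇒length-≡ (partialPartition⇒Unique (facet-partial s)) (B∉τ ∷ τ!) (s⊆B∷τ , B∷τ⊆s))
    where
      rest : List Block
      rest = without B (facet s)

      rest-pp : D n rest
      rest-pp = without-partial (facet-partial s)

      earlier : ∃ λ k → k <ᶠ s × rest ⊆ₛ facet k
      earlier = earlier-facet⊇without s B∈s B-splittable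

      rest-overlap : EarlierOverlap s rest
      rest-overlap = (proj₁ earlier , proj₁ (proj₂ earlier) , rest-pp , proj₂ (proj₂ earlier))
                   , rest-pp , λ c∈ → proj₁ (∈-without⁻ (facet s) c∈)

      τ⊆rest : τ ⊆ₛ rest
      τ⊆rest c∈τ = ∈-filter⁺ _ (τ⊆s c∈τ) λ { refl → B∉r (τ⊆r c∈τ) }

      rest⊆τ : rest ⊆ₛ τ
      rest⊆τ = τ-maximal rest rest-overlap τ⊆rest

      B∉τ : All (B ≢_) τ
      B∉τ = All.tabulate λ c∈τ B≡c → B∉r (subst (_∈ facet r) (sym B≡c) (τ⊆r c∈τ))

      s⊆B∷τ : facet s ⊆ₛ (B ∷ τ)
      s⊆B∷τ c∈s with ⊆-∷-without (facet s) c∈s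
      ... | here c≡B     = here c≡B
      ... | there c∈rest = there (rest⊆τ c∈rest)

      B∷τ⊆s : (B ∷ τ) ⊆ₛ facet s
      B∷τ⊆s (here refl)  = B∈s
      B∷τ⊆s (there c∈τ)  = τ⊆s c∈τ

  shelling : Shelling (D n)
  shelling = record
    { t          = t
    ; F          = facet
    ; F-unique   = partialPartition⇒Unique ∘ facet-partial
    ; F-facet    = λ i → covers⇒facet (facet-partial i) (facet-covers i)
    ; F-complete = facet-complete
    ; F-distinct = facet-injective
    ; F-shell    = shell
    }

lemma3p2 : (n : ℕ) → Shellable (D n)
lemma3p2 n = LexicographicShelling.shelling n
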